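{- Let $k\ge 2$ be an integer and let $F$ be a $(k+2,k)$-free $3$-uniform hypergraph. Let $S$ be a $k$-maximal $(\ell+1,\ell)$-configuration of $F$ with $\ell\in[2,k-1]$. Then all of the following hold: (1) $e(F[V(S)])\le k-1$; (2) there is no edge $e\in E(F)$ with $|e\cap V(S)|=2$; (3) there are no edges $e,f\in E(F)$ with $|e\cap V(S)|=|f\cap V(S)|=1$ and $e\setminus V(S)=f\setminus V(S)$; (4) the graph $H$ with $V(H)=V(F)\setminus V(S)$ and $E(H)=\{T\in\binom{V(H)}{2}:\ \exists e\in E(F),\ |e\cap V(S)|=1,\ e\setminus V(S)=T\}$ is a forest each of whose components has at most $k-\ell$ vertices; and consequently $$e(F)-e(F\setminus V(S))\le \left(1-\frac{1}{k}\right)(v(F)-v(S))+(k-1).$$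
   Context: All hypergraphs are finite with edges forming a set. In a $3$-uniform hypergraph, an $(s,k)$-configuration is a collection of $k$ edges whose union has at most $s$ vertices; a hypergraph is $(s,k)$-free if it contains no $(s,k)$-configuration. For a set $S$ of edges, $V(S)$ is the union of its edges and $v(S)=|V(S)|$. $v(F)$ and $e(F)$ denote the numbers of vertices and edges of $F$; $F[X]$ is the subhypergraph induced on $X$ (all edges of $F$ contained in $X$), and $F\setminus X$ is the hypergraph obtained by deleting the vertices in $X$ (i.e. $F[V(F)\setminus X]$). Given $k\ge 2$ and $\ell\in[2,k-1]$, an $(\ell+1,\ell)$-configuration $S$ in a $(k+2,k)$-free $3$-uniform hypergraph $F$ is called $k$-maximal if there is no $(\ell'+1,\ell')$-configuration $S'$ of $F$ with $S\subseteq S'$ and $\ell<\ell'\le k-1$. -}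

module Defs where

open import Data.Nat using (ℕ; suc; _+_; _*_; _∸_; _≤_; _<_)
open import Data.Fin using (Fin)
open import Data.Fin.Subset using (Subset; _∈_; _∉_; _⊆_; _∩_; _∪_; _─_; ⋃; ∁; ∣_∣; ⁅_⁆)
open import Data.Fin.Subset.Properties using (_∈?_; _⊆?_)
open import Data.List using (List; []; _∷_; _++_; [_]; map; filter; allFin; length)
open import Data.List.Relation.Unary.All using (All)
open import Data.List.Relation.Unary.Linked using (Linked)
open import Data.List.Relation.Unary.Unique.Propositional using (Unique)
open import Data.Vec using (tabulate)
open import Data.Product using (Σ; ∃; _×_)
open import Relation.Nullary using (¬_; does)
open import Relation.Binary.PropositionalEquality using (_≡_; _≢_)
open import Relation.Binary.Construct.Closure.ReflexiveTransitive using (Star)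
open import Function.Definitions using (Injective)

record Hypergraph3 (n : ℕ) : Set where
  field
    m        : ℕ
    edge     : Fin m → Subset n
    uniform  : ∀ i → ∣ edge i ∣ ≡ 3
    distinct : Injective _≡_ _≡_ edge
open Hypergraph3 public

module _ {n : ℕ} (F : Hypergraph3 n) where

  EdgeSet : Set
  EdgeSet = Subset (m F)

  V : EdgeSet → Subset n
  V S = ⋃ (map (edge F) (filter (_∈? S) (allFin (m F))))

  IsConfig : ℕ → ℕ → EdgeSet → Set
  IsConfig s k S = ∣ S ∣ ≡ k × ∣ V S ∣ ≤ s

  Free : ℕ → ℕ → Set
  Free s k = ∀ (S : EdgeSet) → ¬ IsConfig s k S

  KMaximal : ℕ → ℕ → EdgeSet → Set
  KMaximal k ℓ S =
    IsConfig (suc ℓ) ℓ S ×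
    ¬ (Σ EdgeSet λ S' → Σ ℕ λ ℓ' →
         S ⊆ S' × ℓ < ℓ' × ℓ' ≤ k ∸ 1 × IsConfig (suc ℓ') ℓ' S')

  eInduced : Subset n → ℕ
  eInduced X = ∣ tabulate (λ i → does (edge F i ⊆? X)) ∣

  eDelete : Subset n → ℕ
  eDelete X = eInduced (∁ X)

  LinkAdj : Subset n → Fin n → Fin n → Set
  LinkAdj X x y = x ∉ X × y ∉ X × x ≢ y ×
    ∃ λ (i : Fin (m F)) → ∣ edge F i ∩ X ∣ ≡ 1 × edge F i ─ X ≡ ⁅ x ⁆ ∪ ⁅ y ⁆

  HasCycle : (Fin n → Fin n → Set) → Set
  HasCycle Adj = Σ (Fin n) λ a → Σ (Fin n) λ b → Σ (Fin n) λ c → Σ (List (Fin n)) λ rest →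
    Unique (a ∷ b ∷ c ∷ rest) × Linked Adj ((a ∷ b ∷ c ∷ rest) ++ [ a ])

  ForestWithSmallComponents : Subset n → ℕ → Set
  ForestWithSmallComponents X t =
    ¬ HasCycle (LinkAdj X) ×
    (∀ (x : Fin n) → x ∉ X → ∀ (L : List (Fin n)) →
       Unique L → All (Star (LinkAdj X) x) L → length L ≤ t)

module Submission where

-- Write X = V(S). Maximality of S and (k+2,k)-freeness forbid any S' ⊇ S with
-- ℓ < ∣ S' ∣ ≤ k spanning at most ∣ S' ∣ + 1 vertices; so every edge outside S has two
-- vertices outside X, and a set C of pendant edges (meeting X once) has more than ∣ C ∣
-- vertices outside X, and ∣ C ∣ + 2 of them if ℓ + ∣ C ∣ = k.  Growing C from one pendant
-- edge by edges that touch it outside X therefore stops at a closed set with ℓ + ∣ C ∣ < k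
-- and exactly ∣ C ∣ + 1 outside vertices, i.e. a tree component of H with at most k − ℓ
-- vertices.  Splitting any set T of pendant edges into such components gives
-- k ∣ T ∣ ≤ (k − 1) ∣ V(T) ─ X ∣, which excludes twin pendant edges and cycles in H and,
-- with e(F[X]) ≤ ℓ, bounds the number of edges meeting X.

open import Defs
open import Data.Nat using (ℕ; zero; suc; _+_; _*_; _∸_; _≤_; _<_; z≤n; s≤s; z<s; _≟_)
open import Data.Nat.Properties
open import Data.Fin using (Fin)
import Data.Fin.Properties as Fin
open import Data.Fin.Subset
open import Data.Fin.Subset.Properties
open import Data.Vec using ([]; _∷_; tabulate)
open import Data.Vec.Base using (here; there)
import Data.Vec.Properties as Vec
open import Data.List using (List; []; _∷_; _++_; [_]; length; allFin)
open import Data.List.Relation.Unary.All using (All; []; _∷_)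
import Data.List.Relation.Unary.All as All
import Data.List.Relation.Unary.All.Properties as All
import Data.List.Relation.Unary.Any as Any
open import Data.List.Relation.Unary.AllPairs using (_∷_)
open import Data.List.Relation.Unary.Unique.Propositional using (Unique)
open import Data.List.Relation.Unary.Linked using (Linked; []; [-]; _∷_)
import Data.List.Membership.Propositional as List
import Data.List.Membership.Propositional.Properties as List
open import Data.Product using (Σ; ∃; _×_; _,_; proj₁; proj₂)
import Data.Product
open import Data.Sum using (_⊎_; inj₁; inj₂; [_,_]′)
import Data.Sum
open import Data.Empty using (⊥-elim)
open import Function using (_∘_)
open import Relation.Nullary using (¬_; Dec; yes; no; does; ¬?; contradiction)
open import Relation.Nullary.Decidable using (_×-dec_; decidable-stable)
open import Relation.Unary using (Decidable)
open import Relation.Binary.PropositionalEquality hiding ([_])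
open import Relation.Binary.Construct.Closure.ReflexiveTransitive using (Star; ε; _◅_)
import Relation.Binary.Construct.Closure.ReflexiveTransitive as ReflexiveTransitive

private
  variable
    n : ℕ
    x y z : Fin n
    p q : Subset n

∣p∪q∣≤∣p∣+∣q∣ : (p q : Subset n) → ∣ p ∪ q ∣ ≤ ∣ p ∣ + ∣ q ∣
∣p∪q∣≤∣p∣+∣q∣ []            []            = z≤n
∣p∪q∣≤∣p∣+∣q∣ (inside ∷ p)  (inside ∷ q)  =
  s≤s (≤-trans (∣p∪q∣≤∣p∣+∣q∣ p q) (+-monoʳ-≤ ∣ p ∣ (n≤1+n _)))
∣p∪q∣≤∣p∣+∣q∣ (inside ∷ p)  (outside ∷ q) = s≤s (∣p∪q∣≤∣p∣+∣q∣ p q)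
∣p∪q∣≤∣p∣+∣q∣ (outside ∷ p) (inside ∷ q)  =
  ≤-trans (s≤s (∣p∪q∣≤∣p∣+∣q∣ p q)) (≤-reflexive (sym (+-suc _ _)))
∣p∪q∣≤∣p∣+∣q∣ (outside ∷ p) (outside ∷ q) = ∣p∪q∣≤∣p∣+∣q∣ p q

∣p∣≡∣p∩q∣+∣p─q∣ : (p q : Subset n) → ∣ p ∣ ≡ ∣ p ∩ q ∣ + ∣ p ─ q ∣
∣p∣≡∣p∩q∣+∣p─q∣ []            []            = refl
∣p∣≡∣p∩q∣+∣p─q∣ (inside ∷ p)  (inside ∷ q)  = cong suc (∣p∣≡∣p∩q∣+∣p─q∣ p q)
∣p∣≡∣p∩q∣+∣p─q∣ (inside ∷ p)  (outside ∷ q) =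
  trans (cong suc (∣p∣≡∣p∩q∣+∣p─q∣ p q)) (sym (+-suc _ _))
∣p∣≡∣p∩q∣+∣p─q∣ (outside ∷ p) (inside ∷ q)  = ∣p∣≡∣p∩q∣+∣p─q∣ p q
∣p∣≡∣p∩q∣+∣p─q∣ (outside ∷ p) (outside ∷ q) = ∣p∣≡∣p∩q∣+∣p─q∣ p q

disjoint⇒∣p∪q∣≡∣p∣+∣q∣ : (p q : Subset n) → (∀ {x} → x ∈ p → x ∉ q) →
                        ∣ p ∪ q ∣ ≡ ∣ p ∣ + ∣ q ∣
disjoint⇒∣p∪q∣≡∣p∣+∣q∣ []            []            _        = refl
disjoint⇒∣p∪q∣≡∣p∣+∣q∣ (inside ∷ p)  (inside ∷ q)  disjoint = ⊥-elim (disjoint here here)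
disjoint⇒∣p∪q∣≡∣p∣+∣q∣ (inside ∷ p)  (outside ∷ q) disjoint =
  cong suc (disjoint⇒∣p∪q∣≡∣p∣+∣q∣ p q (λ x∈p x∈q → disjoint (there x∈p) (there x∈q)))
disjoint⇒∣p∪q∣≡∣p∣+∣q∣ (outside ∷ p) (inside ∷ q)  disjoint =
  trans (cong suc (disjoint⇒∣p∪q∣≡∣p∣+∣q∣ p q (λ x∈p x∈q → disjoint (there x∈p) (there x∈q))))
        (sym (+-suc _ _))
disjoint⇒∣p∪q∣≡∣p∣+∣q∣ (outside ∷ p) (outside ∷ q) disjoint =
  disjoint⇒∣p∪q∣≡∣p∣+∣q∣ p q (λ x∈p x∈q → disjoint (there x∈p) (there x∈q))

x∈p─q⁻ : (p q : Subset n) → x ∈ p ─ q → x ∈ p × x ∉ q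
x∈p─q⁻ (inside ∷ p) (outside ∷ q) here       = here , λ ()
x∈p─q⁻ (_ ∷ p)      (inside ∷ q)  (there x∈) = Data.Product.map there (_∘ drop-there) (x∈p─q⁻ p q x∈)
x∈p─q⁻ (_ ∷ p)      (outside ∷ q) (there x∈) = Data.Product.map there (_∘ drop-there) (x∈p─q⁻ p q x∈)

x∈p⇒0<∣p∣ : x ∈ p → 0 < ∣ p ∣
x∈p⇒0<∣p∣ x∈p = ≤-<-trans z≤n (x∈p⇒∣p-x∣<∣p∣ x∈p)

∣p∣≡0⇒x∉p : ∣ p ∣ ≡ 0 → x ∉ p
∣p∣≡0⇒x∉p ∣p∣≡0 x∈p = n≮0 (subst (0 <_) ∣p∣≡0 (x∈p⇒0<∣p∣ x∈p))

∣p∪⁅x⁆∣≡1+∣p∣ : x ∉ p → ∣ p ∪ ⁅ x ⁆ ∣ ≡ suc ∣ p ∣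
∣p∪⁅x⁆∣≡1+∣p∣ {x = x} {p = p} x∉p = begin
  ∣ p ∪ ⁅ x ⁆ ∣   ≡⟨ disjoint⇒∣p∪q∣≡∣p∣+∣q∣ p ⁅ x ⁆ (λ y∈p y∈⁅x⁆ → x∉p (subst (_∈ p) (x∈⁅y⁆⇒x≡y x y∈⁅x⁆) y∈p)) ⟩
  ∣ p ∣ + ∣ ⁅ x ⁆ ∣ ≡⟨ cong (∣ p ∣ +_) (∣⁅x⁆∣≡1 x) ⟩
  ∣ p ∣ + 1       ≡⟨ +-comm ∣ p ∣ 1 ⟩
  suc ∣ p ∣       ∎
  where open ≡-Reasoning

∪-lub : {r : Subset n} → p ⊆ r → q ⊆ r → p ∪ q ⊆ r
∪-lub {p = p} {q = q} p⊆r q⊆r x∈ = [ p⊆r , q⊆r ]′ (x∈p∪q⁻ p q x∈)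

∣p∪q∣≤∣p∣+∣q─p∣ : (p q : Subset n) → ∣ p ∪ q ∣ ≤ ∣ p ∣ + ∣ q ─ p ∣
∣p∪q∣≤∣p∣+∣q─p∣ p q = ≤-trans (p⊆q⇒∣p∣≤∣q∣ (∪-lub (p⊆p∪q _) q⊆p∪[q─p])) (∣p∪q∣≤∣p∣+∣q∣ p (q ─ p))
  where
  q⊆p∪[q─p] : q ⊆ p ∪ (q ─ p)
  q⊆p∪[q─p] {x} x∈q with x ∈? p
  ... | yes x∈p = x∈p∪q⁺ (inj₁ x∈p)
  ... | no  x∉p = x∈p∪q⁺ (inj₂ (x∈p∧x∉q⇒x∈p─q x∈q x∉p))

∈⁅⁆-elim : (P : Fin n → Set) → P x → y ∈ ⁅ x ⁆ → P y
∈⁅⁆-elim {x = x} P Px y∈⁅x⁆ = subst P (sym (x∈⁅y⁆⇒x≡y x y∈⁅x⁆)) Px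

x∈⁅y⁆∪⁅z⁆⁻ : x ∈ ⁅ y ⁆ ∪ ⁅ z ⁆ → x ≡ y ⊎ x ≡ z
x∈⁅y⁆∪⁅z⁆⁻ {y = y} {z = z} x∈ with x∈p∪q⁻ ⁅ y ⁆ ⁅ z ⁆ x∈
... | inj₁ x∈⁅y⁆ = inj₁ (x∈⁅y⁆⇒x≡y y x∈⁅y⁆)
... | inj₂ x∈⁅z⁆ = inj₂ (x∈⁅y⁆⇒x≡y z x∈⁅z⁆)

y∈⁅y⁆∪⁅z⁆ : (y z : Fin n) → y ∈ ⁅ y ⁆ ∪ ⁅ z ⁆
y∈⁅y⁆∪⁅z⁆ y z = x∈p∪q⁺ (inj₁ (x∈⁅x⁆ y))

z∈⁅y⁆∪⁅z⁆ : (y z : Fin n) → z ∈ ⁅ y ⁆ ∪ ⁅ z ⁆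
z∈⁅y⁆∪⁅z⁆ y z = x∈p∪q⁺ (inj₂ (x∈⁅x⁆ z))

Unique⇒length≤∣p∣ : (p : Subset n) {L : List (Fin n)} → Unique L → All (_∈ p) L → length L ≤ ∣ p ∣
Unique⇒length≤∣p∣ p {[]}    _              _           = z≤n
Unique⇒length≤∣p∣ p {x ∷ L} (x∉L ∷ unique) (x∈p ∷ L⊆p) =
  <-≤-trans (s≤s (Unique⇒length≤∣p∣ (p - x) unique (All.zipWith L⊆p-x (L⊆p , x∉L))))
            (x∈p⇒∣p-x∣<∣p∣ x∈p)
  where
  L⊆p-x : ∀ {y} → y ∈ p × x ≢ y → y ∈ p - x
  L⊆p-x (y∈p , x≢y) = x∈p∧x≢y⇒x∈p-y y∈p (x≢y ∘ sym)

module _ {P : Fin n → Set} (P? : Decidable P) where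

  ∈-select⁺ : ∀ {i} → P i → i ∈ tabulate (λ j → does (P? j))
  ∈-select⁺ {i} Pi = Vec.lookup⇒[]= i _ (trans (Vec.lookup∘tabulate _ i) (does-true (P? i)))
    where
    does-true : (d : Dec (P i)) → does d ≡ inside
    does-true (yes _)  = refl
    does-true (no ¬Pi) = contradiction Pi ¬Pi

  ∈-select⁻ : ∀ {i} → i ∈ tabulate (λ j → does (P? j)) → P i
  ∈-select⁻ {i} i∈ = true-does (P? i) (trans (sym (Vec.lookup∘tabulate _ i)) (Vec.[]=⇒lookup i∈))
    where
    true-does : (d : Dec (P i)) → does d ≡ inside → P i
    true-does (yes Pi) _ = Pi

x∈⋃⁻ : (L : List (Subset n)) → x ∈ ⋃ L → ∃ λ p → p List.∈ L × x ∈ p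
x∈⋃⁻ []      x∈ = ⊥-elim (∉⊥ x∈)
x∈⋃⁻ (p ∷ L) x∈ with x∈p∪q⁻ p (⋃ L) x∈
... | inj₁ x∈p = p , Any.here refl , x∈p
... | inj₂ x∈⋃L with x∈⋃⁻ L x∈⋃L
...   | q , q∈L , x∈q = q , Any.there q∈L , x∈q

x∈⋃⁺ : (L : List (Subset n)) → p List.∈ L → x ∈ p → x ∈ ⋃ L
x∈⋃⁺ (_ ∷ L) (Any.here refl) x∈p = x∈p∪q⁺ (inj₁ x∈p)
x∈⋃⁺ (_ ∷ L) (Any.there p∈L) x∈p = x∈p∪q⁺ (inj₂ (x∈⋃⁺ L p∈L x∈p))

linked⇒star : ∀ {A : Set} {R : A → A → Set} {x} xs {y} → Linked R (x ∷ xs ++ [ y ]) → Star R x y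
linked⇒star []       (Rxy ∷ [-]) = Rxy ◅ ε
linked⇒star (_ ∷ xs) (Rxz ∷ Rzs) = Rxz ◅ linked⇒star xs Rzs

1+a*c≤a*w : ∀ {a c w} → c ≤ a → c < w → suc a * c ≤ a * w
1+a*c≤a*w {a} {c} {w} c≤a c<w = begin
  suc a * c     ≤⟨ +-monoˡ-≤ (a * c) c≤a ⟩
  a + a * c     ≡⟨ *-suc a c ⟨
  a * suc c     ≤⟨ *-monoʳ-≤ a c<w ⟩
  a * w         ∎
  where open ≤-Reasoning

module _ (F : Hypergraph3 n) where

  ∈V⁻ : ∀ {S} → x ∈ V F S → ∃ λ i → i ∈ S × x ∈ edge F i
  ∈V⁻ {S = S} x∈ with x∈⋃⁻ _ x∈
  ... | p , p∈ , x∈p with List.∈-map∘filter⁻ (edge F) {P = _∈ S} (_∈? S) {xs = allFin (m F)} p∈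
  ...   | i , _ , refl , i∈S = i , i∈S , x∈p

  ∈V⁺ : ∀ {S i} → i ∈ S → edge F i ⊆ V F S
  ∈V⁺ {S = S} {i = i} i∈S =
    x∈⋃⁺ _ (List.∈-map∘filter⁺ (edge F) {P = _∈ S} (_∈? S) {xs = allFin (m F)} (i , List.∈-allFin i , refl , i∈S))

  V-mono : ∀ {S T} → S ⊆ T → V F S ⊆ V F T
  V-mono S⊆T x∈ with ∈V⁻ x∈
  ... | i , i∈S , x∈i = ∈V⁺ (S⊆T i∈S) x∈i

  V-∪ : ∀ {S T} → V F (S ∪ T) ⊆ V F S ∪ V F T
  V-∪ {S = S} {T = T} x∈ with ∈V⁻ x∈
  ... | i , i∈ , x∈i = [ (λ i∈S → x∈p∪q⁺ (inj₁ (∈V⁺ i∈S x∈i)))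
                       , (λ i∈T → x∈p∪q⁺ (inj₂ (∈V⁺ i∈T x∈i))) ]′ (x∈p∪q⁻ S T i∈)

  V-⁅⁆ : ∀ i → V F ⁅ i ⁆ ⊆ edge F i
  V-⁅⁆ i x∈ with ∈V⁻ x∈
  ... | j , j∈⁅i⁆ , x∈j = subst (λ j → _ ∈ edge F j) (x∈⁅y⁆⇒x≡y i j∈⁅i⁆) x∈j

module MaximalConfiguration
  (k₁ ℓ : ℕ) (ℓ≤k₁ : ℓ ≤ k₁) (F : Hypergraph3 n) (free : Free F (suc k₁ + 2) (suc k₁))
  (S : EdgeSet F) (maximal : KMaximal F (suc k₁) ℓ S)
  where

  k : ℕ
  k = suc k₁

  X : Subset n
  X = V F S

  outer : Fin (m F) → Subset n
  outer i = edge F i ─ X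

  Vout : EdgeSet F → Subset n
  Vout C = V F C ─ X

  Pendant : Fin (m F) → Set
  Pendant i = ∣ edge F i ∩ X ∣ ≡ 1

  pendants : EdgeSet F
  pendants = tabulate (λ i → does (∣ edge F i ∩ X ∣ ≟ 1))

  ∈pendants⁺ : ∀ {i} → Pendant i → i ∈ pendants
  ∈pendants⁺ = ∈-select⁺ (λ i → ∣ edge F i ∩ X ∣ ≟ 1)

  ∈pendants⁻ : ∀ {i} → i ∈ pendants → Pendant i
  ∈pendants⁻ = ∈-select⁻ (λ i → ∣ edge F i ∩ X ∣ ≟ 1)

  Fresh : EdgeSet F → Set
  Fresh C = ∀ {i} → i ∈ C → i ∉ S

  Thin : EdgeSet F → Set
  Thin C = ∣ Vout C ∣ ≤ suc ∣ C ∣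

  ∣S∣≡ℓ : ∣ S ∣ ≡ ℓ
  ∣S∣≡ℓ = proj₁ (proj₁ maximal)

  ∣X∣≤1+ℓ : ∣ X ∣ ≤ suc ℓ
  ∣X∣≤1+ℓ = proj₂ (proj₁ maximal)

  no-tight-extension : ∀ {S' s} → S ⊆ S' → ∣ S' ∣ ≡ s → ℓ < s → s ≤ k → ¬ ∣ V F S' ∣ ≤ suc s
  no-tight-extension {S'} {s} S⊆S' ∣S'∣≡s ℓ<s s≤k tight with s ≟ k
  ... | yes refl = free S' (∣S'∣≡s , ≤-trans tight (≤-trans (n≤1+n (suc k)) (≤-reflexive (+-comm 2 k))))
  ... | no s≢k   = proj₂ maximal (S' , s , S⊆S' , ℓ<s , <⇒≤pred (≤∧≢⇒< s≤k s≢k) , ∣S'∣≡s , tight)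

  ∣edge∩X∣≤3 : ∀ i → ∣ edge F i ∩ X ∣ ≤ 3
  ∣edge∩X∣≤3 i = ≤-trans (∣p∩q∣≤∣p∣ (edge F i) X) (≤-reflexive (uniform F i))

  ∣outer∣≡3∸∣edge∩X∣ : ∀ i → ∣ outer i ∣ ≡ 3 ∸ ∣ edge F i ∩ X ∣
  ∣outer∣≡3∸∣edge∩X∣ i = begin
    ∣ outer i ∣                                              ≡⟨ m+n∸m≡n ∣ edge F i ∩ X ∣ _ ⟨
    ∣ edge F i ∩ X ∣ + ∣ outer i ∣ ∸ ∣ edge F i ∩ X ∣           ≡⟨ cong (_∸ ∣ edge F i ∩ X ∣) (∣p∣≡∣p∩q∣+∣p─q∣ (edge F i) X) ⟨
    ∣ edge F i ∣ ∸ ∣ edge F i ∩ X ∣                            ≡⟨ cong (_∸ ∣ edge F i ∩ X ∣) (uniform F i) ⟩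
    3 ∸ ∣ edge F i ∩ X ∣                                     ∎
    where open ≡-Reasoning

  ∣outer∣≡2 : ∀ {i} → Pendant i → ∣ outer i ∣ ≡ 2
  ∣outer∣≡2 {i} pendant = trans (∣outer∣≡3∸∣edge∩X∣ i) (cong (3 ∸_) pendant)

  ∈S⇒∣edge∩X∣≡3 : ∀ {i} → i ∈ S → ∣ edge F i ∩ X ∣ ≡ 3
  ∈S⇒∣edge∩X∣≡3 {i} i∈S = ≤-antisym (∣edge∩X∣≤3 i)
    (subst (_≤ ∣ edge F i ∩ X ∣) (uniform F i) (p⊆q⇒∣p∣≤∣q∣ (λ x∈ → x∈p∩q⁺ (x∈ , ∈V⁺ F i∈S x∈))))

  ⊆pendants⇒fresh : ∀ {C} → C ⊆ pendants → Fresh C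
  ⊆pendants⇒fresh C⊆pendants i∈C i∈S with trans (sym (∈S⇒∣edge∩X∣≡3 i∈S)) (∈pendants⁻ (C⊆pendants i∈C))
  ... | ()

  outer⊆Vout : ∀ {C i} → i ∈ C → outer i ⊆ Vout C
  outer⊆Vout {i = i} i∈C x∈ with x∈p─q⁻ (edge F i) X x∈
  ... | x∈i , x∉X = x∈p∧x∉q⇒x∈p─q (∈V⁺ F i∈C x∈i) x∉X

  Vout-mono : ∀ {C T} → C ⊆ T → Vout C ⊆ Vout T
  Vout-mono {C} C⊆T x∈ with x∈p─q⁻ (V F C) X x∈
  ... | x∈V , x∉X = x∈p∧x∉q⇒x∈p─q (V-mono F C⊆T x∈V) x∉X

  Vout-⁅⁆ : ∀ i → Vout ⁅ i ⁆ ⊆ outer i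
  Vout-⁅⁆ i x∈ with x∈p─q⁻ (V F ⁅ i ⁆) X x∈
  ... | x∈V , x∉X = x∈p∧x∉q⇒x∈p─q (V-⁅⁆ F i x∈V) x∉X

  Vout-∪⁅⁆ : ∀ C i → Vout (C ∪ ⁅ i ⁆) ⊆ Vout C ∪ outer i
  Vout-∪⁅⁆ C i x∈ with x∈p─q⁻ (V F (C ∪ ⁅ i ⁆)) X x∈
  ... | x∈V , x∉X = [ (λ x∈C → x∈p∪q⁺ (inj₁ (x∈p∧x∉q⇒x∈p─q x∈C x∉X)))
                    , (λ x∈i → x∈p∪q⁺ (inj₂ (x∈p∧x∉q⇒x∈p─q (V-⁅⁆ F i x∈i) x∉X))) ]′
                    (x∈p∪q⁻ (V F C) (V F ⁅ i ⁆) (V-∪ F x∈V))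

  ∣S∪C∣≡ℓ+∣C∣ : ∀ {C} → Fresh C → ∣ S ∪ C ∣ ≡ ℓ + ∣ C ∣
  ∣S∪C∣≡ℓ+∣C∣ {C} fresh =
    trans (disjoint⇒∣p∪q∣≡∣p∣+∣q∣ S C (λ i∈S i∈C → fresh i∈C i∈S)) (cong (_+ ∣ C ∣) ∣S∣≡ℓ)

  ∣V[S∪C]∣≤1+ℓ+∣VoutC∣ : ∀ C → ∣ V F (S ∪ C) ∣ ≤ suc ℓ + ∣ Vout C ∣
  ∣V[S∪C]∣≤1+ℓ+∣VoutC∣ C = begin
    ∣ V F (S ∪ C) ∣       ≤⟨ p⊆q⇒∣p∣≤∣q∣ V[S∪C]⊆X∪VoutC ⟩
    ∣ X ∪ Vout C ∣        ≤⟨ ∣p∪q∣≤∣p∣+∣q∣ X (Vout C) ⟩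
    ∣ X ∣ + ∣ Vout C ∣    ≤⟨ +-monoˡ-≤ ∣ Vout C ∣ ∣X∣≤1+ℓ ⟩
    suc ℓ + ∣ Vout C ∣    ∎
    where
    open ≤-Reasoning
    V[S∪C]⊆X∪VoutC : V F (S ∪ C) ⊆ X ∪ Vout C
    V[S∪C]⊆X∪VoutC {x} x∈ with x ∈? X | x∈p∪q⁻ X (V F C) (V-∪ F x∈)
    ... | yes x∈X | _          = x∈p∪q⁺ (inj₁ x∈X)
    ... | no  x∉X | inj₁ x∈X   = contradiction x∈X x∉X
    ... | no  x∉X | inj₂ x∈VC  = x∈p∪q⁺ (inj₂ (x∈p∧x∉q⇒x∈p─q x∈VC x∉X))

  fresh-expands : ∀ {C} → Fresh C → 0 < ∣ C ∣ → ℓ + ∣ C ∣ ≤ k → ∣ C ∣ < ∣ Vout C ∣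
  fresh-expands {C} fresh 0<∣C∣ ℓ+∣C∣≤k = ≰⇒> λ ∣VoutC∣≤∣C∣ →
    no-tight-extension (p⊆p∪q C) (∣S∪C∣≡ℓ+∣C∣ fresh) (m<m+n ℓ 0<∣C∣) ℓ+∣C∣≤k
      (≤-trans (∣V[S∪C]∣≤1+ℓ+∣VoutC∣ C) (+-monoʳ-≤ (suc ℓ) ∣VoutC∣≤∣C∣))

  thin⇒ℓ+∣C∣≢k : ∀ {C} → Fresh C → Thin C → ℓ + ∣ C ∣ ≢ k
  thin⇒ℓ+∣C∣≢k {C} fresh thin ℓ+∣C∣≡k = free (S ∪ C) (trans (∣S∪C∣≡ℓ+∣C∣ fresh) ℓ+∣C∣≡k , (begin
    ∣ V F (S ∪ C) ∣          ≤⟨ ∣V[S∪C]∣≤1+ℓ+∣VoutC∣ C ⟩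
    suc ℓ + ∣ Vout C ∣       ≤⟨ +-monoʳ-≤ (suc ℓ) thin ⟩
    suc ℓ + suc ∣ C ∣        ≡⟨ cong suc (+-suc ℓ ∣ C ∣) ⟩
    2 + (ℓ + ∣ C ∣)          ≡⟨ cong (2 +_) ℓ+∣C∣≡k ⟩
    2 + k                    ≡⟨ +-comm 2 k ⟩
    k + 2                    ∎))
    where open ≤-Reasoning

  ∉S⇒1<∣outer∣ : ∀ {i} → i ∉ S → 1 < ∣ outer i ∣
  ∉S⇒1<∣outer∣ {i} i∉S = <-≤-trans 1<∣Vout⁅i⁆∣ (p⊆q⇒∣p∣≤∣q∣ (Vout-⁅⁆ i))
    where
    1<∣Vout⁅i⁆∣ : 1 < ∣ Vout ⁅ i ⁆ ∣
    1<∣Vout⁅i⁆∣ = subst (λ c → 0 < c → ℓ + c ≤ k → c < ∣ Vout ⁅ i ⁆ ∣) (∣⁅x⁆∣≡1 i)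
      (fresh-expands (∈⁅⁆-elim (_∉ S) i∉S)) z<s (≤-trans (≤-reflexive (+-comm ℓ 1)) (s≤s ℓ≤k₁))

  Step : EdgeSet F → Fin n → Fin n → Set
  Step T u w = ∃ λ f → f ∈ T × outer f ≡ ⁅ u ⁆ ∪ ⁅ w ⁆

  record Component (T C : EdgeSet F) : Set where
    field
      C⊆T    : C ⊆ T
      short  : ℓ + ∣ C ∣ < k
      thin   : Thin C
      closed : ∀ {f y} → f ∈ T → f ∉ C → y ∈ outer f → y ∉ Vout C

  module _ {T : EdgeSet F} (T⊆pendants : T ⊆ pendants) where

    thin-extend : ∀ {C f y} → Thin C → f ∈ T → f ∉ C → y ∈ outer f → y ∈ Vout C → Thin (C ∪ ⁅ f ⁆)
    thin-extend {C} {f} {y} thin f∈T f∉C y∈f y∈C = begin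
      ∣ Vout (C ∪ ⁅ f ⁆) ∣                     ≤⟨ p⊆q⇒∣p∣≤∣q∣ (Vout-∪⁅⁆ C f) ⟩
      ∣ Vout C ∪ outer f ∣                     ≤⟨ ∣p∪q∣≤∣p∣+∣q─p∣ (Vout C) (outer f) ⟩
      ∣ Vout C ∣ + ∣ outer f ─ Vout C ∣         ≤⟨ +-mono-≤ thin ∣f─C∣≤1 ⟩
      suc ∣ C ∣ + 1                            ≡⟨ +-comm (suc ∣ C ∣) 1 ⟩
      suc (suc ∣ C ∣)                          ≡⟨ cong suc (∣p∪⁅x⁆∣≡1+∣p∣ f∉C) ⟨
      suc ∣ C ∪ ⁅ f ⁆ ∣                        ∎
      where
      open ≤-Reasoning
      ∣f─C∣≤1 : ∣ outer f ─ Vout C ∣ ≤ 1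
      ∣f─C∣≤1 = ≤-pred (subst (∣ outer f ─ Vout C ∣ <_) (∣outer∣≡2 (∈pendants⁻ (T⊆pendants f∈T)))
                  (p∩q≢∅⇒∣p─q∣<∣p∣ (outer f) (Vout C) (y , x∈p∩q⁺ (y∈f , y∈C))))

    private
      Touching : EdgeSet F → Fin (m F) → Set
      Touching C f = f ∈ T × f ∉ C × ∃ λ y → y ∈ outer f × y ∈ Vout C

      touching? : ∀ C → Decidable (Touching C)
      touching? C f = f ∈? T ×-dec ¬? (f ∈? C) ×-dec Fin.any? (λ y → y ∈? outer f ×-dec y ∈? Vout C)

    -- Adding a touching edge keeps C thin, so by thin⇒ℓ+∣C∣≢k the fuel never runs out.
    grow : ∀ fuel {C} → ℓ + ∣ C ∣ + fuel ≡ k → C ⊆ T → Thin C → ∃ λ C' → C ⊆ C' × Component T C'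
    grow zero {C} ≡k C⊆T thin =
      contradiction (trans (sym (+-identityʳ _)) ≡k) (thin⇒ℓ+∣C∣≢k (⊆pendants⇒fresh (T⊆pendants ∘ C⊆T)) thin)
    grow (suc fuel) {C} ≡k C⊆T thin with Fin.any? (touching? C)
    ... | no ¬touching = C , ⊆-refl , record
      { C⊆T    = C⊆T
      ; short  = subst (ℓ + ∣ C ∣ <_) ≡k (m<m+n _ z<s)
      ; thin   = thin
      ; closed = λ f∈T f∉C y∈f y∈C → ¬touching (_ , f∈T , f∉C , _ , y∈f , y∈C)
      }
    ... | yes (f , f∈T , f∉C , y , y∈f , y∈C)
      with grow fuel {C ∪ ⁅ f ⁆} ≡k′ (∪-lub C⊆T (∈⁅⁆-elim (_∈ T) f∈T)) (thin-extend thin f∈T f∉C y∈f y∈C)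
      where
      ≡k′ : ℓ + ∣ C ∪ ⁅ f ⁆ ∣ + fuel ≡ k
      ≡k′ = begin
        ℓ + ∣ C ∪ ⁅ f ⁆ ∣ + fuel   ≡⟨ cong (λ c → ℓ + c + fuel) (∣p∪⁅x⁆∣≡1+∣p∣ f∉C) ⟩
        ℓ + suc ∣ C ∣ + fuel       ≡⟨ cong (_+ fuel) (+-suc ℓ ∣ C ∣) ⟩
        suc (ℓ + ∣ C ∣ + fuel)     ≡⟨ +-suc _ fuel ⟨
        ℓ + ∣ C ∣ + suc fuel       ≡⟨ ≡k ⟩
        k                          ∎
        where open ≡-Reasoning
    ... | C' , C∪f⊆C' , component = C' , C∪f⊆C' ∘ p⊆p∪q _ , component

    component : ∀ {e} → e ∈ T → ∃ λ C → e ∈ C × Component T C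
    component {e} e∈T with grow (k ∸ (ℓ + 1)) ≡k (∈⁅⁆-elim (_∈ T) e∈T) thin⁅e⁆
      where
      ≡k : ℓ + ∣ ⁅ e ⁆ ∣ + (k ∸ (ℓ + 1)) ≡ k
      ≡k = trans (cong (λ c → ℓ + c + (k ∸ (ℓ + 1))) (∣⁅x⁆∣≡1 e))
                 (m+[n∸m]≡n (≤-trans (≤-reflexive (+-comm ℓ 1)) (s≤s ℓ≤k₁)))
      thin⁅e⁆ : Thin ⁅ e ⁆
      thin⁅e⁆ = ≤-trans (p⊆q⇒∣p∣≤∣q∣ (Vout-⁅⁆ e))
                  (≤-reflexive (trans (∣outer∣≡2 (∈pendants⁻ (T⊆pendants e∈T))) (cong suc (sym (∣⁅x⁆∣≡1 e)))))
    ... | C , ⁅e⁆⊆C , comp = C , ⁅e⁆⊆C (x∈⁅x⁆ e) , comp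

  module _ {T C : EdgeSet F} (comp : Component T C) where
    open Component comp

    closed-reach : ∀ {u w} → Star (Step T) u w → u ∈ Vout C → w ∈ Vout C
    closed-reach ε                                u∈C = u∈C
    closed-reach {u} ((f , f∈T , f≡uv) ◅ path) u∈C with f ∈? C
    ... | yes f∈C = closed-reach path (outer⊆Vout f∈C (subst (_ ∈_) (sym f≡uv) (z∈⁅y⁆∪⁅z⁆ u _)))
    ... | no  f∉C = contradiction u∈C (closed f∈T f∉C (subst (u ∈_) (sym f≡uv) (y∈⁅y⁆∪⁅z⁆ u _)))

    Vout-rest-disjoint : ∀ {x} → x ∈ Vout C → x ∉ Vout (T ─ C)
    Vout-rest-disjoint x∈C x∈rest with x∈p─q⁻ (V F (T ─ C)) X x∈rest
    ... | x∈V , x∉X with ∈V⁻ F x∈V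
    ...   | f , f∈T─C , x∈f with x∈p─q⁻ T C f∈T─C
    ...     | f∈T , f∉C = closed f∈T f∉C (x∈p∧x∉q⇒x∈p─q x∈f x∉X) x∈C

  component-bound : ∀ {T C e} → T ⊆ pendants → Component T C → e ∈ C → k * ∣ C ∣ ≤ k₁ * ∣ Vout C ∣
  component-bound T⊆pendants comp e∈C = 1+a*c≤a*w (m+n≤o⇒n≤o ℓ (≤-pred short))
    (fresh-expands (⊆pendants⇒fresh (T⊆pendants ∘ C⊆T)) (x∈p⇒0<∣p∣ e∈C) (<⇒≤ short))
    where open Component comp

  pendant-bound : ∀ {T} → T ⊆ pendants → k * ∣ T ∣ ≤ k₁ * ∣ Vout T ∣
  pendant-bound {T} = bound (suc ∣ T ∣) ≤-refl
    where
    bound : ∀ fuel {T} → ∣ T ∣ < fuel → T ⊆ pendants → k * ∣ T ∣ ≤ k₁ * ∣ Vout T ∣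
    bound (suc fuel) {T} ∣T∣<fuel T⊆pendants with nonempty? T
    ... | no  empty = ≤-trans (≤-reflexive k*∣T∣≡0) z≤n
      where
      k*∣T∣≡0 : k * ∣ T ∣ ≡ 0
      k*∣T∣≡0 = trans (cong (λ t → k * ∣ t ∣) (Empty-unique empty)) (trans (cong (k *_) (∣⊥∣≡0 (m F))) (*-zeroʳ k))
    ... | yes (e , e∈T) with component T⊆pendants e∈T
    ...   | C , e∈C , comp = begin
      k * ∣ T ∣                                    ≤⟨ *-monoʳ-≤ k ∣T∣≤∣C∣+∣T─C∣ ⟩
      k * (∣ C ∣ + ∣ T ─ C ∣)                       ≡⟨ *-distribˡ-+ k ∣ C ∣ _ ⟩
      k * ∣ C ∣ + k * ∣ T ─ C ∣                     ≤⟨ +-mono-≤ (component-bound T⊆pendants comp e∈C)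
                                                               (bound fuel ∣T─C∣<fuel (T⊆pendants ∘ p─q⊆p T C)) ⟩
      k₁ * ∣ Vout C ∣ + k₁ * ∣ Vout (T ─ C) ∣       ≡⟨ *-distribˡ-+ k₁ _ _ ⟨
      k₁ * (∣ Vout C ∣ + ∣ Vout (T ─ C) ∣)          ≡⟨ cong (k₁ *_) (disjoint⇒∣p∪q∣≡∣p∣+∣q∣ _ _ (Vout-rest-disjoint comp)) ⟨
      k₁ * ∣ Vout C ∪ Vout (T ─ C) ∣                ≤⟨ *-monoʳ-≤ k₁ (p⊆q⇒∣p∣≤∣q∣ (∪-lub (Vout-mono C⊆T) (Vout-mono (p─q⊆p T C)))) ⟩
      k₁ * ∣ Vout T ∣                              ∎
      where
      open ≤-Reasoning
      open Component comp
      ∣T∣≤∣C∣+∣T─C∣ : ∣ T ∣ ≤ ∣ C ∣ + ∣ T ─ C ∣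
      ∣T∣≤∣C∣+∣T─C∣ = ≤-trans (≤-reflexive (∣p∣≡∣p∩q∣+∣p─q∣ T C)) (+-monoˡ-≤ _ (∣p∩q∣≤∣q∣ T C))
      ∣T─C∣<fuel : ∣ T ─ C ∣ < fuel
      ∣T─C∣<fuel = <-≤-trans (p∩q≢∅⇒∣p─q∣<∣p∣ T C (e , x∈p∩q⁺ (e∈T , e∈C))) (≤-pred ∣T∣<fuel)

  pendant-expands : ∀ {T} → T ⊆ pendants → Nonempty T → ¬ ∣ Vout T ∣ ≤ ∣ T ∣
  pendant-expands {T} T⊆pendants (_ , e∈T) ∣VoutT∣≤∣T∣ = n≮n (k₁ * ∣ T ∣) (begin-strict
    k₁ * ∣ T ∣           <⟨ m<n+m _ (x∈p⇒0<∣p∣ e∈T) ⟩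
    k * ∣ T ∣            ≤⟨ pendant-bound T⊆pendants ⟩
    k₁ * ∣ Vout T ∣      ≤⟨ *-monoʳ-≤ k₁ ∣VoutT∣≤∣T∣ ⟩
    k₁ * ∣ T ∣           ∎)
    where open ≤-Reasoning

  induced⊆S : tabulate (λ i → does (edge F i ⊆? X)) ⊆ S
  induced⊆S {i} i∈ with i ∈? S
  ... | yes i∈S = i∈S
  ... | no  i∉S = contradiction (<-≤-trans (∉S⇒1<∣outer∣ i∉S) ∣outer∣≤0) n≮0
    where
    outer⊆⊥ : outer i ⊆ ⊥
    outer⊆⊥ x∈ with x∈p─q⁻ (edge F i) X x∈
    ... | x∈i , x∉X = contradiction (∈-select⁻ (λ j → edge F j ⊆? X) i∈ x∈i) x∉X
    ∣outer∣≤0 : ∣ outer i ∣ ≤ 0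
    ∣outer∣≤0 = ≤-trans (p⊆q⇒∣p∣≤∣q∣ outer⊆⊥) (≤-reflexive (∣⊥∣≡0 n))

  eInduced≤k₁ : eInduced F X ≤ k₁
  eInduced≤k₁ = ≤-trans (p⊆q⇒∣p∣≤∣q∣ induced⊆S) (≤-trans (≤-reflexive ∣S∣≡ℓ) ℓ≤k₁)

  no-edge-meets-twice : ¬ Σ (Fin (m F)) λ i → ∣ edge F i ∩ X ∣ ≡ 2
  no-edge-meets-twice (i , ≡2) with i ∈? S
  ... | yes i∈S = contradiction (trans (sym (∈S⇒∣edge∩X∣≡3 i∈S)) ≡2) λ ()
  ... | no  i∉S = n≮n 1 (subst (1 <_) (trans (∣outer∣≡3∸∣edge∩X∣ i) (cong (3 ∸_) ≡2)) (∉S⇒1<∣outer∣ i∉S))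

  no-twin-pendants : ¬ Σ (Fin (m F)) λ i → Σ (Fin (m F)) λ j → i ≢ j
                       × Pendant i × Pendant j × outer i ≡ outer j
  no-twin-pendants (i , j , i≢j , pendant-i , pendant-j , i≡j) =
    pendant-expands twins⊆pendants (i , x∈p∪q⁺ (inj₁ (x∈⁅x⁆ i))) (begin
      ∣ Vout twins ∣        ≤⟨ p⊆q⇒∣p∣≤∣q∣ (∪-lub (Vout-⁅⁆ i) (⊆-reflexive (sym i≡j)) ∘ Vout-∪⁅⁆ ⁅ i ⁆ j) ⟩
      ∣ outer i ∣           ≡⟨ ∣outer∣≡2 pendant-i ⟩
      2                    ≡⟨ cong suc (∣⁅x⁆∣≡1 i) ⟨
      suc ∣ ⁅ i ⁆ ∣         ≡⟨ ∣p∪⁅x⁆∣≡1+∣p∣ (x≢y⇒x∉⁅y⁆ (i≢j ∘ sym)) ⟨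
      ∣ twins ∣             ∎)
    where
    open ≤-Reasoning
    twins : EdgeSet F
    twins = ⁅ i ⁆ ∪ ⁅ j ⁆
    twins⊆pendants : twins ⊆ pendants
    twins⊆pendants = ∪-lub (∈⁅⁆-elim (_∈ pendants) (∈pendants⁺ pendant-i))
                           (∈⁅⁆-elim (_∈ pendants) (∈pendants⁺ pendant-j))

  outer-separates : ∀ {f g v} → v ∈ outer f → v ∉ outer g → f ≢ g
  outer-separates v∈f v∉g refl = v∉g v∈f

  ∉pair : ∀ {u v w : Fin n} → v ≢ u → v ≢ w → v ∉ ⁅ u ⁆ ∪ ⁅ w ⁆
  ∉pair v≢u v≢w v∈ = [ v≢u , v≢w ]′ (x∈⁅y⁆∪⁅z⁆⁻ v∈)

  no-chord : ∀ {T C g} → T ⊆ pendants → Component T C → Pendant g → g ∉ C → ¬ outer g ⊆ Vout C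
  no-chord {T} {C} {g} T⊆pendants comp pendant-g g∉C g⊆C =
    pendant-expands C∪g⊆pendants (g , x∈p∪q⁺ (inj₂ (x∈⁅x⁆ g))) (begin
      ∣ Vout (C ∪ ⁅ g ⁆) ∣   ≤⟨ p⊆q⇒∣p∣≤∣q∣ (∪-lub ⊆-refl g⊆C ∘ Vout-∪⁅⁆ C g) ⟩
      ∣ Vout C ∣             ≤⟨ thin ⟩
      suc ∣ C ∣              ≡⟨ ∣p∪⁅x⁆∣≡1+∣p∣ g∉C ⟨
      ∣ C ∪ ⁅ g ⁆ ∣          ∎)
    where
    open ≤-Reasoning
    open Component comp
    C∪g⊆pendants : C ∪ ⁅ g ⁆ ⊆ pendants
    C∪g⊆pendants = ∪-lub (T⊆pendants ∘ C⊆T) (∈⁅⁆-elim (_∈ pendants) (∈pendants⁺ pendant-g))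

  -- The path from c round to a avoids b, so it lies in the component of the edge bc among
  -- the pendant edges other than the edge g = ab; then g is a chord of that component.
  acyclic : ¬ HasCycle F (LinkAdj F X)
  acyclic (a , b , c , rest , ((a≢b ∷ a≢c ∷ _) ∷ (b≢c ∷ b∉rest) ∷ _) ,
           ((_ , _ , _ , g , pendant-g , g≡ab) ∷ (_ , _ , _ , e , pendant-e , e≡bc) ∷ path)) =
    chord (component (p─q⊆p pendants ⁅ g ⁆) e∈T)
    where
    T : EdgeSet F
    T = pendants ─ ⁅ g ⁆
    b∈g : b ∈ outer g
    b∈g = subst (b ∈_) (sym g≡ab) (z∈⁅y⁆∪⁅z⁆ a b)
    b∈e : b ∈ outer e
    b∈e = subst (b ∈_) (sym e≡bc) (y∈⁅y⁆∪⁅z⁆ b c)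
    c∈e : c ∈ outer e
    c∈e = subst (c ∈_) (sym e≡bc) (z∈⁅y⁆∪⁅z⁆ b c)
    e∈T : e ∈ T
    e∈T = x∈p∧x∉q⇒x∈p─q (∈pendants⁺ pendant-e)
            (x≢y⇒x∉⁅y⁆ (outer-separates c∈e (subst (c ∉_) (sym g≡ab) (∉pair (a≢c ∘ sym) (b≢c ∘ sym)))))
    avoiding-b : ∀ {xs} → All (b ≢_) xs → Linked (LinkAdj F X) xs → Linked (Step T) xs
    avoiding-b _                  []  = []
    avoiding-b _                  [-] = [-]
    avoiding-b (b≢u ∷ b≢w ∷ b∉ws) ((_ , _ , _ , f , pendant-f , f≡uw) ∷ path) =
      (f , x∈p∧x∉q⇒x∈p─q (∈pendants⁺ pendant-f)
             (x≢y⇒x∉⁅y⁆ (outer-separates b∈g (subst (b ∉_) (sym f≡uw) (∉pair b≢u b≢w)) ∘ sym)) , f≡uw)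
      ∷ avoiding-b (b≢w ∷ b∉ws) path
    chord : ¬ (∃ λ C → e ∈ C × Component T C)
    chord (C , e∈C , comp) =
      no-chord (p─q⊆p pendants ⁅ g ⁆) comp pendant-g g∉C
        (subst (_⊆ Vout C) (sym g≡ab) (∪-lub (∈⁅⁆-elim (_∈ Vout C) a∈C) (∈⁅⁆-elim (_∈ Vout C) (outer⊆Vout e∈C b∈e))))
      where
      a∈C : a ∈ Vout C
      a∈C = closed-reach comp (linked⇒star rest (avoiding-b (b≢c ∷ All.++⁺ b∉rest ((a≢b ∘ sym) ∷ [])) path))
              (outer⊆Vout e∈C c∈e)
      g∉C : g ∉ C
      g∉C g∈C = proj₂ (x∈p─q⁻ pendants ⁅ g ⁆ (Component.C⊆T comp g∈C)) (x∈⁅x⁆ g)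

  link⇒step : ∀ {u w} → LinkAdj F X u w → Step pendants u w
  link⇒step (_ , _ , _ , f , pendant-f , f≡uw) = f , ∈pendants⁺ pendant-f , f≡uw

  small-components : ∀ x → x ∉ X → ∀ L → Unique L → All (Star (LinkAdj F X) x) L → length L ≤ k ∸ ℓ
  small-components x _ L unique reachable with Fin.any? (λ i → i ∈? pendants ×-dec x ∈? outer i)
  ... | no isolated =
    ≤-trans (Unique⇒length≤∣p∣ ⁅ x ⁆ unique (All.map stays reachable))
            (≤-trans (≤-reflexive (∣⁅x⁆∣≡1 x)) (m+n≤o⇒m≤o∸n 1 (s≤s ℓ≤k₁)))
    where
    stays : ∀ {y} → Star (LinkAdj F X) x y → y ∈ ⁅ x ⁆
    stays ε                      = x∈⁅x⁆ x
    stays (x~w ◅ _) with link⇒step x~w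
    ... | f , f∈pendants , f≡xw = contradiction (f , f∈pendants , subst (x ∈_) (sym f≡xw) (y∈⁅y⁆∪⁅z⁆ x _)) isolated
  ... | yes (i , i∈pendants , x∈i) with component ⊆-refl i∈pendants
  ...   | C , i∈C , comp =
    ≤-trans (Unique⇒length≤∣p∣ (Vout C) unique
              (All.map (λ x~y → closed-reach comp (ReflexiveTransitive.map link⇒step x~y) (outer⊆Vout i∈C x∈i)) reachable))
            (≤-trans thin (m+n≤o⇒m≤o∸n (suc ∣ C ∣) (subst (_≤ k) (cong suc (+-comm ℓ ∣ C ∣)) short)))
    where open Component comp

  edge-classes : ∀ i → edge F i ⊆ ∁ X ⊎ edge F i ⊆ X ⊎ Pendant i
  edge-classes i with ∣ edge F i ∩ X ∣ in ∣i∩X∣≡ | ∣outer∣≡3∸∣edge∩X∣ i | ∣edge∩X∣≤3 i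
  ... | 0 | _ | _ = inj₁ λ x∈i → x∉p⇒x∈∁p λ x∈X → ∣p∣≡0⇒x∉p ∣i∩X∣≡ (x∈p∩q⁺ (x∈i , x∈X))
  ... | 1 | _ | _ = inj₂ (inj₂ refl)
  ... | 2 | _ | _ = contradiction (i , ∣i∩X∣≡) no-edge-meets-twice
  ... | 3 | ∣outer∣≡0 | _ =
    inj₂ (inj₁ λ {x} x∈i → decidable-stable (x ∈? X) (∣p∣≡0⇒x∉p ∣outer∣≡0 ∘ x∈p∧x∉q⇒x∈p─q x∈i))
  ... | suc (suc (suc (suc _))) | _ | s≤s (s≤s (s≤s ()))

  edge-count : k * (m F ∸ eDelete F X) ≤ k₁ * (n ∸ ∣ X ∣) + k * k₁
  edge-count = begin
    k * (m F ∸ eDelete F X)                    ≤⟨ *-monoʳ-≤ k (m≤n+o⇒m∸n≤o (m F) (eDelete F X) m≤classes) ⟩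
    k * (eInduced F X + ∣ pendants ∣)           ≡⟨ *-distribˡ-+ k (eInduced F X) _ ⟩
    k * eInduced F X + k * ∣ pendants ∣         ≤⟨ +-mono-≤ (*-monoʳ-≤ k eInduced≤k₁) (pendant-bound ⊆-refl) ⟩
    k * k₁ + k₁ * ∣ Vout pendants ∣             ≤⟨ +-monoʳ-≤ (k * k₁) (*-monoʳ-≤ k₁ ∣Vout∣≤n∸∣X∣) ⟩
    k * k₁ + k₁ * (n ∸ ∣ X ∣)                   ≡⟨ +-comm (k * k₁) _ ⟩
    k₁ * (n ∸ ∣ X ∣) + k * k₁                   ∎
    where
    open ≤-Reasoning
    disjointE inducedE : EdgeSet F
    disjointE = tabulate (λ i → does (edge F i ⊆? ∁ X))
    inducedE  = tabulate (λ i → does (edge F i ⊆? X))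
    covered : ∀ i → i ∈ disjointE ∪ (inducedE ∪ pendants)
    covered i = x∈p∪q⁺ (Data.Sum.map (∈-select⁺ (λ j → edge F j ⊆? ∁ X))
                  (x∈p∪q⁺ ∘ Data.Sum.map (∈-select⁺ (λ j → edge F j ⊆? X)) ∈pendants⁺) (edge-classes i))
    m≤classes : m F ≤ eDelete F X + (eInduced F X + ∣ pendants ∣)
    m≤classes = begin
      m F                                        ≡⟨ ∣⊤∣≡n (m F) ⟨
      ∣ ⊤ {m F} ∣                                ≤⟨ p⊆q⇒∣p∣≤∣q∣ {p = ⊤} (λ {i} _ → covered i) ⟩
      ∣ disjointE ∪ (inducedE ∪ pendants) ∣       ≤⟨ ∣p∪q∣≤∣p∣+∣q∣ disjointE _ ⟩
      ∣ disjointE ∣ + ∣ inducedE ∪ pendants ∣     ≤⟨ +-monoʳ-≤ ∣ disjointE ∣ (∣p∪q∣≤∣p∣+∣q∣ inducedE pendants) ⟩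
      eDelete F X + (eInduced F X + ∣ pendants ∣) ∎
    ∣Vout∣≤n∸∣X∣ : ∣ Vout pendants ∣ ≤ n ∸ ∣ X ∣
    ∣Vout∣≤n∸∣X∣ = ≤-trans (p⊆q⇒∣p∣≤∣q∣ (x∉p⇒x∈∁p ∘ proj₂ ∘ x∈p─q⁻ (V F pendants) X)) (≤-reflexive (∣∁p∣≡n∸∣p∣ X))

lemma2p2 : ∀ {n : ℕ} (k ℓ : ℕ) → 2 ≤ k → 2 ≤ ℓ → ℓ ≤ k ∸ 1 →
    (F : Hypergraph3 n) → Free F (k + 2) k →
    (S : EdgeSet F) → KMaximal F k ℓ S →
    (eInduced F (V F S) ≤ k ∸ 1)
    × (¬ Σ (Fin (m F)) λ i → ∣ edge F i ∩ V F S ∣ ≡ 2)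
    × (¬ Σ (Fin (m F)) λ i → Σ (Fin (m F)) λ j → i ≢ j
         × ∣ edge F i ∩ V F S ∣ ≡ 1 × ∣ edge F j ∩ V F S ∣ ≡ 1
         × edge F i ─ V F S ≡ edge F j ─ V F S)
    × ForestWithSmallComponents F (V F S) (k ∸ ℓ)
    × (k * (m F ∸ eDelete F (V F S)) ≤ (k ∸ 1) * (n ∸ ∣ V F S ∣) + k * (k ∸ 1))
lemma2p2 zero _ () _ _ _ _ _ _
lemma2p2 (suc k₁) ℓ _ _ ℓ≤k₁ F free S maximal =
  eInduced≤k₁ , no-edge-meets-twice , no-twin-pendants , (acyclic , small-components) , edge-count
  where open MaximalConfiguration k₁ ℓ ℓ≤k₁ F free S maximal
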